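{- In any Huffman tree for positive weights $w_1,\ldots,w_n$, the depths of any two nodes of equal weight differ by at most $1$.
   Context: Huffman's algorithm starts with $n$ one-node trees (leaves) labelled $w_1,\ldots,w_n$ and repeatedly removes two trees whose root labels are smallest and joins them as the two children of a new root labelled with the sum of their labels, until one tree remains; ties between equal labels may be broken arbitrarily and the order of the two children may be chosen arbitrarily. Every tree obtainable this way is a Huffman tree for $w_1,\ldots,w_n$. The weight of a node is its label (for a leaf, the corresponding $w_i$; for an internal node, the sum of the weights of its two children). The depth of a node is the length of the path from the root to it.
   Formalization: The weights $w_1,\ldots,w_n$ are positive rationals. -}

module Defs where

open import Data.Nat using (ℕ; zero; suc)
open import Data.Rational using (ℚ; 0ℚ; _+_; _≤_; _<_)
open import Data.List using (List; []; _∷_; map)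
open import Data.List.Relation.Unary.All using (All)
open import Data.List.Relation.Binary.Permutation.Propositional using (_↭_)
open import Data.Product using (_×_)

data Tree : Set where
  leaf : ℚ → Tree
  node : Tree → Tree → Tree

weight : Tree → ℚ
weight (leaf w)   = w
weight (node l r) = weight l + weight r

-- One step of Huffman's algorithm on a forest (multiset of trees, as a list up
-- to permutation): remove two trees t₁ t₂ whose root labels are smallest
-- (every remaining tree has weight ≥ both), and add node t₁ t₂.
-- Ties and child order are arbitrary (any choice of t₁, t₂ in any order).
data HuffStep : List Tree → List Tree → Set where
  step : ∀ {F} t₁ t₂ R →
         F ↭ (t₁ ∷ t₂ ∷ R) →
         All (λ t → weight t₁ ≤ weight t × weight t₂ ≤ weight t) R →
         HuffStep F (node t₁ t₂ ∷ R)

data HuffRun : List Tree → List Tree → Set where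
  done : ∀ {F} → HuffRun F F
  more : ∀ {F G H} → HuffStep F G → HuffRun G H → HuffRun F H

IsHuffmanTree : List ℚ → Tree → Set
IsHuffmanTree ws t = HuffRun (map leaf ws) (t ∷ [])

data NodeAt : Tree → ℕ → Tree → Set where
  here  : ∀ {t} → NodeAt t zero t
  left  : ∀ {l r d s} → NodeAt l d s → NodeAt (node l r) (suc d) s
  right : ∀ {l r d s} → NodeAt r d s → NodeAt (node l r) (suc d) s

-- Read a run of Huffman's algorithm backwards: at each stage the final tree is a skeleton whose
-- holes are the trees of the current forest. This skeleton stays monotone (a node strictly deeper
-- than another is no heavier) when the merge of l and r is undone, because every other tree of
-- the forest weighs at least M = max(l, r): a skeleton node y strictly deeper than the new children
-- has a sibling z ≥ M with y + z ≤ l + r, whence y ≤ min(l, r), while every skeleton node above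
-- the new children weighs at least M. In the final skeleton, a node y two levels below x has its
-- parent below x, so y + z ≤ x for its sibling z > 0, and x and y cannot have equal weight.
module Submission where

open import Defs
open import Data.Nat using (ℕ; suc; _≤_)
open import Data.Rational using (ℚ; 0ℚ; _<_)
open import Data.List using (List)
open import Data.List.Relation.Unary.All using (All)
open import Relation.Binary.PropositionalEquality using (_≡_)

open import Data.Nat using (zero; s≤s) renaming (_<_ to _<ₙ_)
import Data.Nat.Properties as ℕ
open import Data.Rational using (_+_; _⊔_) renaming (_≤_ to _≤ℚ_)
import Data.Rational.Properties as Q
open import Data.List using ([]; _∷_; _++_; map)
open import Data.List.Relation.Unary.All using ([]; _∷_)
import Data.List.Relation.Unary.All as All
import Data.List.Relation.Unary.All.Properties as AllP
open import Data.List.Relation.Unary.Any using (here)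
import Data.List.Relation.Unary.Any.Properties as AnyP
open import Data.List.Membership.Propositional using (_∈_)
open import Data.List.Relation.Binary.Permutation.Propositional
  using (_↭_; prep; ↭-refl; ↭-sym; ↭-trans)
open import Data.List.Relation.Binary.Permutation.Propositional.Properties
  using (All-resp-↭; ∈-resp-↭; ++⁺ʳ; ++⁺ˡ; shifts; drop-∷)
open import Data.Product using (∃; ∃₂; _×_; _,_)
open import Data.Sum using (_⊎_; inj₁; inj₂)
import Data.Sum as Sum
import Data.Product as Product
open import Data.Empty using (⊥-elim)
open import Function using (_∘_)
open import Relation.Binary.PropositionalEquality using (refl; sym; trans; cong; subst)

p≤p+q : ∀ p {q} → 0ℚ ≤ℚ q → p ≤ℚ p + q
p≤p+q p {q} 0≤q = subst (_≤ℚ p + q) (Q.+-identityʳ p) (Q.+-monoʳ-≤ p 0≤q)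

p<p+q : ∀ p {q} → 0ℚ < q → p < p + q
p<p+q p {q} 0<q = subst (_< p + q) (Q.+-identityʳ p) (Q.+-monoʳ-< p 0<q)

+-cancelʳ-≤ : ∀ r {p q} → p + r ≤ℚ q + r → p ≤ℚ q
+-cancelʳ-≤ r p+r≤q+r = Q.≮⇒≥ λ q<p → Q.<-irrefl refl (Q.<-≤-trans (Q.+-monoˡ-< r q<p) p+r≤q+r)

data Skeleton : Set where
  hole : Tree → Skeleton
  fork : Skeleton → Skeleton → Skeleton

plug : Skeleton → Tree
plug (hole t)   = t
plug (fork a b) = node (plug a) (plug b)

holes : Skeleton → List Tree
holes (hole t)   = t ∷ []
holes (fork a b) = holes a ++ holes b

-- The nodes of plug sk that are not strictly inside a hole.
data OuterAt : Skeleton → ℕ → Tree → Set where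
  here  : ∀ {sk} → OuterAt sk zero (plug sk)
  left  : ∀ {a b d t} → OuterAt a d t → OuterAt (fork a b) (suc d) t
  right : ∀ {a b d t} → OuterAt b d t → OuterAt (fork a b) (suc d) t

data HoleAt : Skeleton → ℕ → Tree → Set where
  here  : ∀ {t} → HoleAt (hole t) zero t
  left  : ∀ {a b d t} → HoleAt a d t → HoleAt (fork a b) (suc d) t
  right : ∀ {a b d t} → HoleAt b d t → HoleAt (fork a b) (suc d) t

HoleAt⇒OuterAt : ∀ {sk d t} → HoleAt sk d t → OuterAt sk d t
HoleAt⇒OuterAt here      = here
HoleAt⇒OuterAt (left h)  = left (HoleAt⇒OuterAt h)
HoleAt⇒OuterAt (right h) = right (HoleAt⇒OuterAt h)

∈-holes⇒HoleAt : ∀ sk {t} → t ∈ holes sk → ∃ λ d → HoleAt sk d t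
∈-holes⇒HoleAt (hole t)   (here refl) = zero , here
∈-holes⇒HoleAt (fork a b) t∈ with AnyP.++⁻ (holes a) t∈
... | inj₁ t∈a = Product.map suc left (∈-holes⇒HoleAt a t∈a)
... | inj₂ t∈b = Product.map suc right (∈-holes⇒HoleAt b t∈b)

otherHoles : ∀ {sk d t} → HoleAt sk d t → List Tree
otherHoles here                = []
otherHoles (left {b = b} h)    = otherHoles h ++ holes b
otherHoles (right {a = a} h)   = holes a ++ otherHoles h

holes-otherHoles : ∀ {sk d t} (h : HoleAt sk d t) → holes sk ↭ t ∷ otherHoles h
holes-otherHoles here              = ↭-refl
holes-otherHoles (left {b = b} h)  = ++⁺ʳ (holes b) (holes-otherHoles h)
holes-otherHoles (right {a = a} {t = t} h) =
  ↭-trans (++⁺ˡ (holes a) (holes-otherHoles h)) (shifts (holes a) (t ∷ []))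

↭-holes⇒HoleAt : ∀ sk {t ts} → holes sk ↭ t ∷ ts →
                 ∃₂ λ d (h : HoleAt sk d t) → otherHoles h ↭ ts
↭-holes⇒HoleAt sk holes↭ with ∈-holes⇒HoleAt sk (∈-resp-↭ (↭-sym holes↭) (here refl))
... | d , h = d , h , drop-∷ (↭-trans (↭-sym (holes-otherHoles h)) holes↭)

expand : ∀ {sk d l r} → HoleAt sk d (node l r) → Skeleton
expand {l = l} {r} here = fork (hole l) (hole r)
expand (left {b = b} h)  = fork (expand h) b
expand (right {a = a} h) = fork a (expand h)

plug-expand : ∀ {sk d l r} (h : HoleAt sk d (node l r)) → plug (expand h) ≡ plug sk
plug-expand here              = refl
plug-expand (left {b = b} h)  = cong (λ u → node u (plug b)) (plug-expand h)
plug-expand (right {a = a} h) = cong (node (plug a)) (plug-expand h)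

holes-expand : ∀ {sk d l r} (h : HoleAt sk d (node l r)) → holes (expand h) ↭ l ∷ r ∷ otherHoles h
holes-expand here              = ↭-refl
holes-expand (left {b = b} h)  = ++⁺ʳ (holes b) (holes-expand h)
holes-expand {l = l} {r} (right {a = a} h) =
  ↭-trans (++⁺ˡ (holes a) (holes-expand h)) (shifts (holes a) (l ∷ r ∷ []))

OuterAt-expand : ∀ {sk d l r e u} (h : HoleAt sk d (node l r)) → OuterAt (expand h) e u →
                 OuterAt sk e u ⊎ (e ≡ suc d × (u ≡ l ⊎ u ≡ r))
OuterAt-expand here here               = inj₁ here
OuterAt-expand here (left here)        = inj₂ (refl , inj₁ refl)
OuterAt-expand here (right here)       = inj₂ (refl , inj₂ refl)
OuterAt-expand h@(left _) here         = inj₁ (subst (OuterAt _ zero) (sym (plug-expand h)) here)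
OuterAt-expand h@(right _) here        = inj₁ (subst (OuterAt _ zero) (sym (plug-expand h)) here)
OuterAt-expand (left h) (left o)       = Sum.map left (Product.map₁ (cong suc)) (OuterAt-expand h o)
OuterAt-expand (left h) (right o)      = inj₁ (right o)
OuterAt-expand (right h) (left o)      = inj₁ (left o)
OuterAt-expand (right h) (right o)     = Sum.map right (Product.map₁ (cong suc)) (OuterAt-expand h o)

module _ {P : ℚ → Set} (P-+ : ∀ {p q} → P p → P q → P (p + q)) where

  weight-plug : ∀ sk → All (P ∘ weight) (holes sk) → P (weight (plug sk))
  weight-plug (hole t)   (Pt ∷ []) = Pt
  weight-plug (fork a b) P-holes   =
    P-+ (weight-plug a (AllP.++⁻ˡ (holes a) P-holes)) (weight-plug b (AllP.++⁻ʳ (holes a) P-holes))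

  weight-OuterAt : ∀ {sk d t} → All (P ∘ weight) (holes sk) → OuterAt sk d t → P (weight t)
  weight-OuterAt {sk} P-holes here          = weight-plug sk P-holes
  weight-OuterAt {fork a b} P-holes (left o)  = weight-OuterAt (AllP.++⁻ˡ (holes a) P-holes) o
  weight-OuterAt {fork a b} P-holes (right o) = weight-OuterAt (AllP.++⁻ʳ (holes a) P-holes) o

OuterAt-parent : ∀ {sk d y} → OuterAt sk (suc d) y →
                 ∃₂ λ p z → OuterAt sk d p × OuterAt sk (suc d) z × weight p ≡ weight y + weight z
OuterAt-parent (left {b = b} here)  = _ , plug b , here , right here , refl
OuterAt-parent (right {a = a} here) = _ , plug a , here , left here , Q.+-comm (weight (plug a)) _
OuterAt-parent (left {d = suc _} o)  with OuterAt-parent o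
... | p , z , p-at , z-at , eq = p , z , left p-at , left z-at , eq
OuterAt-parent (right {d = suc _} o) with OuterAt-parent o
... | p , z , p-at , z-at , eq = p , z , right p-at , right z-at , eq

Monotone : Skeleton → Set
Monotone sk = ∀ {dx dy x y} → OuterAt sk dx x → OuterAt sk dy y → dx <ₙ dy → weight y ≤ℚ weight x

Monotone⇒sibling : ∀ {sk dx dy x y} → Monotone sk → OuterAt sk dx x → OuterAt sk (suc dy) y →
                   dx <ₙ dy → ∃ λ z → OuterAt sk (suc dy) z × weight y + weight z ≤ℚ weight x
Monotone⇒sibling mono x-at y-at dx<dy with OuterAt-parent y-at
... | p , z , p-at , z-at , p≡y+z = z , z-at , subst (_≤ℚ _) p≡y+z (mono x-at p-at dx<dy)

module _ {sk d l r} (h : HoleAt sk d (node l r)) (mono : Monotone sk) {M : ℚ}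
         (0≤M : 0ℚ ≤ℚ M) (l≤M : weight l ≤ℚ M) (r≤M : weight r ≤ℚ M)
         (M≤holes : All ((M ≤ℚ_) ∘ weight) (holes sk)) where

  private
    M≤outer : ∀ {e u} → OuterAt sk e u → M ≤ℚ weight u
    M≤outer = weight-OuterAt (λ {p} M≤p M≤q → Q.≤-trans M≤p (p≤p+q p (Q.≤-trans 0≤M M≤q))) M≤holes

    child≤M : ∀ {u} → u ≡ l ⊎ u ≡ r → weight u ≤ℚ M
    child≤M (inj₁ refl) = l≤M
    child≤M (inj₂ refl) = r≤M

    l+r≤child+M : ∀ {u} → u ≡ l ⊎ u ≡ r → weight l + weight r ≤ℚ weight u + M
    l+r≤child+M (inj₁ refl) = Q.+-monoʳ-≤ (weight l) r≤M
    l+r≤child+M (inj₂ refl) =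
      subst (_≤ℚ weight r + M) (Q.+-comm (weight r) (weight l)) (Q.+-monoʳ-≤ (weight r) l≤M)

    child-above-outer : ∀ {u e y} → u ≡ l ⊎ u ≡ r → OuterAt sk e y → suc d <ₙ e → weight y ≤ℚ weight u
    child-above-outer {u} {y = y} u∈ y-at (s≤s d<e)
      with Monotone⇒sibling mono (HoleAt⇒OuterAt h) y-at d<e
    ... | z , z-at , y+z≤l+r = +-cancelʳ-≤ M (begin
      weight y + M        ≤⟨ Q.+-monoʳ-≤ (weight y) (M≤outer z-at) ⟩
      weight y + weight z ≤⟨ y+z≤l+r ⟩
      weight l + weight r ≤⟨ l+r≤child+M u∈ ⟩
      weight u + M        ∎)
      where open Q.≤-Reasoning

  expand-Monotone : Monotone (expand h)
  expand-Monotone x-at y-at dx<dy with OuterAt-expand h x-at | OuterAt-expand h y-at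
  ... | inj₁ x           | inj₁ y           = mono x y dx<dy
  ... | inj₂ (refl , x∈) | inj₁ y           = child-above-outer x∈ y dx<dy
  ... | inj₁ x           | inj₂ (refl , y∈) = Q.≤-trans (child≤M y∈) (M≤outer x)
  ... | inj₂ (refl , _)  | inj₂ (refl , _)  = ⊥-elim (ℕ.<-irrefl refl dx<dy)

record MonotoneSkeleton (ts : List Tree) (t : Tree) : Set where
  field
    skeleton       : Skeleton
    plug-skeleton  : plug skeleton ≡ t
    holes-skeleton : holes skeleton ↭ ts
    monotone       : Monotone skeleton

open MonotoneSkeleton

NonNegWeights : List Tree → Set
NonNegWeights = All ((0ℚ ≤ℚ_) ∘ weight)

HuffStep-NonNegWeights : ∀ {ts us} → HuffStep ts us → NonNegWeights ts → NonNegWeights us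
HuffStep-NonNegWeights (step l r R ts↭ _) ts≥0 with All-resp-↭ ts↭ ts≥0
... | l≥0 ∷ r≥0 ∷ R≥0 = Q.+-mono-≤ l≥0 r≥0 ∷ R≥0

⊔≤+ : ∀ {p q} → 0ℚ ≤ℚ p → 0ℚ ≤ℚ q → p ⊔ q ≤ℚ p + q
⊔≤+ {p} {q} 0≤p 0≤q = Q.⊔-lub (p≤p+q p 0≤q) (subst (q ≤ℚ_) (Q.+-comm q p) (p≤p+q q 0≤p))

HuffStep-MonotoneSkeleton : ∀ {ts us t} → HuffStep ts us → NonNegWeights ts →
                            MonotoneSkeleton us t → MonotoneSkeleton ts t
HuffStep-MonotoneSkeleton (step l r R ts↭ R≥lr) ts≥0 S
  with All-resp-↭ ts↭ ts≥0 | ↭-holes⇒HoleAt (skeleton S) (holes-skeleton S)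
... | l≥0 ∷ r≥0 ∷ _ | _ , h , others↭R = record
  { skeleton       = expand h
  ; plug-skeleton  = trans (plug-expand h) (plug-skeleton S)
  ; holes-skeleton = ↭-trans (holes-expand h) (↭-trans (prep l (prep r others↭R)) (↭-sym ts↭))
  ; monotone       = expand-Monotone h (monotone S) (Q.≤-trans l≥0 (Q.p≤p⊔q _ _))
                       (Q.p≤p⊔q _ _) (Q.p≤q⊔p (weight l) _) M≤holes
  }
  where
  M≤holes : All ((weight l ⊔ weight r ≤ℚ_) ∘ weight) (holes (skeleton S))
  M≤holes = All-resp-↭ (↭-sym (holes-skeleton S))
              (⊔≤+ l≥0 r≥0 ∷ All.map (λ (l≤ , r≤) → Q.⊔-lub l≤ r≤) R≥lr)

HuffRun-MonotoneSkeleton : ∀ {ts t} → HuffRun ts (t ∷ []) → NonNegWeights ts → MonotoneSkeleton ts t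
HuffRun-MonotoneSkeleton {t = t} done _ = record
  { skeleton = hole t ; plug-skeleton = refl ; holes-skeleton = ↭-refl ; monotone = λ { here here () } }
HuffRun-MonotoneSkeleton (more s run) ts≥0 =
  HuffStep-MonotoneSkeleton s ts≥0 (HuffRun-MonotoneSkeleton run (HuffStep-NonNegWeights s ts≥0))

Monotone⇒lighter : ∀ {sk dx dy x y} → Monotone sk → All ((0ℚ <_) ∘ weight) (holes sk) →
                   OuterAt sk dx x → OuterAt sk dy y → suc dx <ₙ dy → weight y < weight x
Monotone⇒lighter {y = y} mono holes>0 x-at y-at (s≤s dx<dy)
  with Monotone⇒sibling mono x-at y-at dx<dy
... | z , z-at , y+z≤x = Q.<-≤-trans (p<p+q (weight y) 0<z) y+z≤x
  where
  0<z : 0ℚ < weight z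
  0<z = weight-OuterAt (λ {p} 0<p 0<q → Q.<-trans 0<p (p<p+q p 0<q)) holes>0 z-at

IsLeaf : Tree → Set
IsLeaf t = ∃ λ w → t ≡ leaf w

NodeAt⇒OuterAt : ∀ sk → All IsLeaf (holes sk) → ∀ {d s} → NodeAt (plug sk) d s → OuterAt sk d s
NodeAt⇒OuterAt (hole _)   ((_ , refl) ∷ []) here      = here
NodeAt⇒OuterAt (fork a b) _                 here      = here
NodeAt⇒OuterAt (fork a b) leaf-holes        (left n)  = left (NodeAt⇒OuterAt a (AllP.++⁻ˡ (holes a) leaf-holes) n)
NodeAt⇒OuterAt (fork a b) leaf-holes        (right n) = right (NodeAt⇒OuterAt b (AllP.++⁻ʳ (holes a) leaf-holes) n)

lemma5 : (ws : List ℚ) → All (λ w → 0ℚ < w) ws →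
         (t : Tree) → IsHuffmanTree ws t →
         ∀ {d₁ d₂ s₁ s₂} → NodeAt t d₁ s₁ → NodeAt t d₂ s₂ →
         weight s₁ ≡ weight s₂ → d₁ ≤ suc d₂
lemma5 ws ws>0 t run n₁ n₂ s₁≡s₂ = ℕ.≮⇒≥ λ d₂+1<d₁ →
  Q.<-irrefl s₁≡s₂ (Monotone⇒lighter (monotone S) holes>0 (outer n₂) (outer n₁) d₂+1<d₁)
  where
  S : MonotoneSkeleton (map leaf ws) t
  S = HuffRun-MonotoneSkeleton run (AllP.map⁺ (All.map Q.<⇒≤ ws>0))

  holes>0 : All ((0ℚ <_) ∘ weight) (holes (skeleton S))
  holes>0 = All-resp-↭ (↭-sym (holes-skeleton S)) (AllP.map⁺ ws>0)

  outer : ∀ {d s} → NodeAt t d s → OuterAt (skeleton S) d s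
  outer n = NodeAt⇒OuterAt (skeleton S)
              (All-resp-↭ (↭-sym (holes-skeleton S)) (AllP.map⁺ (All.universal (λ w → w , refl) ws)))
              (subst (λ u → NodeAt u _ _) (sym (plug-skeleton S)) n)
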